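{- Let $m$ and $n$ be integers with $0<m<n$. Then the number of fractions in $F_n$ with numerator at most $m$ is \[ \sum_{h=1}^m \mathcal{N}_n(h)=1+n\sum_{h=1}^m\frac{\varphi(h)}{h}-\Phi(m)-\sum_{h=1}^m\sum_{d\mid h}\mu(d)\left\{\frac{n}{d}\right\}. \]
   Context: For a positive integer $n$, the Farey sequence $F_n$ is the set of irreducible fractions $a/b$ with $0<a/b\leq 1$ and $1\leq b\leq n$ (the fraction $0/1$ is excluded, $1/1$ is included). $\mathcal{N}_n(h)$ denotes the number of fractions in $F_n$ whose (reduced) numerator equals $h$. $\varphi$ is Euler's totient function, $\Phi(m)=\sum_{j=1}^m\varphi(j)$, $\mu$ the Möbius function, and $\{x\}=x-\lfloor x\rfloor$ the fractional part. -}

module Defs where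

open import Data.Nat as ℕ using (ℕ; zero; suc; _*_)
open import Data.Nat.Divisibility using (_∣_; _∣?_)
open import Data.Nat.Coprimality using (coprime?)
open import Data.Nat.Primality using (prime?)
open import Data.List using (List; []; _∷_; map; filter; length; foldr; concatMap; upTo)
open import Data.List using (foldr)
open import Data.Product using (_×_; _,_; proj₁)
open import Data.Bool using (Bool; true; false; if_then_else_; not)
open import Data.Integer as ℤ using (ℤ; +_)
open import Data.Rational as ℚ using (ℚ; 0ℚ; _+_; _-_; floor)
open import Relation.Nullary.Decidable using (_×-dec_)
open import Relation.Nullary using (does)
open import Data.Bool using (_∧_)
open import Relation.Binary.PropositionalEquality using (_≡_)

[1…_] : ℕ → List ℕ
[1… n ] = map suc (upTo n)

sumℚ : List ℚ → ℚ
sumℚ = foldr _+_ 0ℚ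

-- Farey sequence F_n: irreducible fractions a/b with 0 < a/b ≤ 1, 1 ≤ b ≤ n,
-- represented by the pair (a , b) of numerator and denominator (gcd a b = 1, 1 ≤ a ≤ b).
Farey : ℕ → List (ℕ × ℕ)
Farey n = concatMap (λ b → map (λ a → (a , b)) (filter (λ a → coprime? a b) [1… b ])) [1… n ]

𝒩 : ℕ → ℕ → ℕ
𝒩 n h = length (filter (λ p → proj₁ p ℕ.≟ h) (Farey n))

φ : ℕ → ℕ
φ n = length (filter (λ k → coprime? k n) [1… n ])

Φ : ℕ → ℕ
Φ m = foldr ℕ._+_ 0 (map φ [1… m ])

divisors : ℕ → List ℕ
divisors n = filter (λ d → d ∣? n) [1… n ]

squarefree : ℕ → Bool
squarefree n = foldr _∧_ true (map (λ d → not (does ((suc (suc d) * suc (suc d)) ∣? n))) (upTo n))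

ω : ℕ → ℕ
ω n = length (filter (λ p → prime? p ×-dec (p ∣? n)) [1… n ])

μ : ℕ → ℤ
μ n = if squarefree n then (ℤ.-1ℤ ℤ.^ ω n) else ℤ.0ℤ

frac : ℚ → ℚ
frac x = x - (floor x ℚ./ 1)

-- A fraction of F_n with numerator h < n is h/b with h ≤ b ≤ n and b coprime to h, so
-- 𝒩_n(h) + φ(h) = #{b ≤ n : b ⊥ h} + [h = 1].  Möbius inversion, Σ_{d ∣ g} μ(d) = [g = 1],
-- turns the count into Σ_{d ∣ h} μ(d)⌊n/d⌋ (by induction on n, since ⌊(N+1)/d⌋ - ⌊N/d⌋ = [d ∣ N+1]).
-- Splitting ⌊n/d⌋ = n/d - {n/d} and using φ(h)/h = Σ_{d ∣ h} μ(d)/d (the same count at n = h)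
-- gives n φ(h)/h - Σ_{d ∣ h} μ(d){n/d}; summing over h ≤ m yields the formula.
-- μ is given by its closed form, so the Möbius identity is derived from μ(pn) = -μ(n) for p ∤ n
-- and μ(pn) = 0 for p ∣ n.

module Submission where

open import Data.Bool using (true; false; T; not)
open import Data.Empty using (⊥-elim)
open import Data.List using (List; []; _∷_; _++_; map; filter; upTo; applyUpTo; foldr; length; concatMap)
import Data.List.Properties as List
open import Data.List.Relation.Unary.All as All using (_∷_)
open import Data.List.Relation.Unary.All.Properties using (all⁺; all⁻; applyUpTo⁺₁; applyUpTo⁻; all-filter)
open import Data.Integer as ℤ using (ℤ; +_; 0ℤ; 1ℤ)
import Data.Integer.Properties as ℤ
open import Data.Integer.Tactic.RingSolver using (solve-∀)
open import Data.Nat as ℕ using (ℕ; zero; suc; _<_; _≤_; z≤n; s≤s; NonZero; _≟_; _<?_; _≤?_)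
import Data.Nat.Properties as ℕ
import Data.Nat.DivMod as ℕ
open import Data.Nat.Coprimality as Coprime using (Coprime; coprime?; coprime-divisor; gcd≡1⇒coprime; coprime⇒gcd≡1)
open import Data.Nat.Divisibility
open import Data.Nat.GCD using (gcd; gcd[m,n]∣m; gcd[m,n]∣n; gcd-greatest; gcd[m,n]≢0; gcd[m,n]≤n; n/gcd[m,n]≢0)
open import Data.Nat.ListAction using (sum)
open import Data.Nat.Primality using (Prime; prime?; prime⇒nonZero; prime⇒nonTrivial; prime⇒irreducible; euclidsLemma; ¬prime[1])
open import Data.Nat.Primality.Factorisation using (factorise)
open import Data.Product using (_×_; _,_; proj₁; proj₂; ∃-syntax)
open import Data.Sum using (inj₁; inj₂; [_,_]′)
open import Function using (_∘_)
open import Function.Bundles using (_⇔_; mk⇔; Equivalence)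
import Function.Properties.Equivalence as ⇔
open import Relation.Binary.Definitions using (Tri; tri<; tri≈; tri>)
open import Relation.Binary.PropositionalEquality
open import Relation.Nullary using (Dec; yes; no; does; ¬_; contradiction)
open import Relation.Nullary.Decidable using (_×-dec_; ¬?)
open import Relation.Unary using (Pred; Decidable)

open import Defs

module _ where
  open import Data.Integer using (_+_; _-_; _*_; -_)

  -- Indicators and sums over initial segments

  -- Matching on the decision keeps 𝟙 (P? x) folded until P? x itself is inspected.
  𝟙 : {P : Set} → Dec P → ℤ
  𝟙 (yes _) = 1ℤ
  𝟙 (no _)  = 0ℤ

  𝟙-yes : {P : Set} (p? : Dec P) → P → 𝟙 p? ≡ 1ℤ
  𝟙-yes (yes _) _ = refl
  𝟙-yes (no ¬p) p = contradiction p ¬p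

  𝟙-no : {P : Set} (p? : Dec P) → ¬ P → 𝟙 p? ≡ 0ℤ
  𝟙-no (yes p) ¬p = contradiction p ¬p
  𝟙-no (no _)  _  = refl

  𝟙-cong : {P Q : Set} (p? : Dec P) (q? : Dec Q) → (P → Q) → (Q → P) → 𝟙 p? ≡ 𝟙 q?
  𝟙-cong (yes _) (yes _) _ _ = refl
  𝟙-cong (no _)  (no _)  _ _ = refl
  𝟙-cong (yes p) (no ¬q) f _ = contradiction (f p) ¬q
  𝟙-cong (no ¬p) (yes q) _ g = contradiction (g q) ¬p

  𝟙-* : {P Q : Set} (p? : Dec P) (q? : Dec Q) → 𝟙 p? * 𝟙 q? ≡ 𝟙 (p? ×-dec q?)
  𝟙-* (yes _) (yes _) = refl
  𝟙-* (yes _) (no _)  = refl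
  𝟙-* (no _)  _       = refl

  𝟙-suc≟suc : ∀ i j → 𝟙 (suc i ≟ suc j) ≡ 𝟙 (i ≟ j)
  𝟙-suc≟suc i j = 𝟙-cong (suc i ≟ suc j) (i ≟ j) ℕ.suc-injective (cong suc)

  ∑< : ℕ → (ℕ → ℤ) → ℤ
  ∑< zero    f = 0ℤ
  ∑< (suc n) f = ∑< n f + f n

  syntax ∑< n (λ i → e) = ∑[ i < n ] e

  ∑<-cong : ∀ n {f g : ℕ → ℤ} → (∀ i → i < n → f i ≡ g i) → ∑< n f ≡ ∑< n g
  ∑<-cong zero    _  = refl
  ∑<-cong (suc n) eq = cong₂ _+_ (∑<-cong n (λ i i<n → eq i (ℕ.m<n⇒m<1+n i<n))) (eq n ℕ.≤-refl)

  ∑<-zero : ∀ n {f : ℕ → ℤ} → (∀ i → i < n → f i ≡ 0ℤ) → ∑< n f ≡ 0ℤ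
  ∑<-zero zero    _  = refl
  ∑<-zero (suc n) eq = cong₂ _+_ (∑<-zero n (λ i i<n → eq i (ℕ.m<n⇒m<1+n i<n))) (eq n ℕ.≤-refl)

  ∑<-+ : ∀ n (f g : ℕ → ℤ) → ∑[ i < n ] (f i + g i) ≡ ∑< n f + ∑< n g
  ∑<-+ zero    f g = refl
  ∑<-+ (suc n) f g = trans (cong (_+ (f n + g n)) (∑<-+ n f g)) (interchange (∑< n f) (∑< n g) (f n) (g n))
    where
    interchange : ∀ a b c d → a + b + (c + d) ≡ a + c + (b + d)
    interchange = solve-∀

  ∑<-neg : ∀ n (f : ℕ → ℤ) → ∑[ i < n ] (- f i) ≡ - ∑< n f
  ∑<-neg zero    f = refl
  ∑<-neg (suc n) f = trans (cong (_+ - f n) (∑<-neg n f)) (sym (ℤ.neg-distrib-+ (∑< n f) (f n)))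

  ∑<-suc : ∀ n (f : ℕ → ℤ) → ∑< (suc n) f ≡ f 0 + ∑[ i < n ] f (suc i)
  ∑<-suc zero    f = ℤ.+-comm 0ℤ (f 0)
  ∑<-suc (suc n) f = trans (cong (_+ f (suc n)) (∑<-suc n f)) (ℤ.+-assoc (f 0) _ _)

  ∑<-++ : ∀ m n (f : ℕ → ℤ) → ∑< (m ℕ.+ n) f ≡ ∑< m f + ∑[ j < n ] f (m ℕ.+ j)
  ∑<-++ m zero    f = trans (cong (λ k → ∑< k f) (ℕ.+-identityʳ m)) (sym (ℤ.+-identityʳ _))
  ∑<-++ m (suc n) f = begin
    ∑< (m ℕ.+ suc n) f                                  ≡⟨ cong (λ k → ∑< k f) (ℕ.+-suc m n) ⟩
    ∑< (m ℕ.+ n) f + f (m ℕ.+ n)                         ≡⟨ cong (_+ f (m ℕ.+ n)) (∑<-++ m n f) ⟩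
    ∑< m f + ∑[ j < n ] f (m ℕ.+ j) + f (m ℕ.+ n)        ≡⟨ ℤ.+-assoc (∑< m f) _ _ ⟩
    ∑< m f + ∑[ j < suc n ] f (m ℕ.+ j)                  ∎
    where open ≡-Reasoning

  ∑<-extend : ∀ {m n} (f : ℕ → ℤ) → m ≤ n → (∀ i → m ≤ i → i < n → f i ≡ 0ℤ) → ∑< n f ≡ ∑< m f
  ∑<-extend {m} f m≤n vanish with k , refl ← ℕ.m≤n⇒∃[o]m+o≡n m≤n = begin
    ∑< (m ℕ.+ k) f                     ≡⟨ ∑<-++ m k f ⟩
    ∑< m f + ∑[ j < k ] f (m ℕ.+ j)    ≡⟨ cong (_+_ (∑< m f)) (∑<-zero k (λ j j<k → vanish (m ℕ.+ j) (ℕ.m≤m+n m j) (ℕ.+-monoʳ-< m j<k))) ⟩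
    ∑< m f + 0ℤ                        ≡⟨ ℤ.+-identityʳ _ ⟩
    ∑< m f                             ∎
    where open ≡-Reasoning

  ∑<-split-at : ∀ {j n} (f : ℕ → ℤ) → j ≤ n → ∑< n f ≡ ∑< j f + ∑[ i < n ] (𝟙 (j ≤? i) * f i)
  ∑<-split-at {j} f j≤n with k , refl ← ℕ.m≤n⇒∃[o]m+o≡n j≤n = begin
    ∑< (j ℕ.+ k) f                                         ≡⟨ ∑<-++ j k f ⟩
    ∑< j f + ∑[ t < k ] f (j ℕ.+ t)                        ≡⟨ cong (_+_ (∑< j f)) (∑<-cong k (λ t _ → sym (selected t))) ⟩
    ∑< j f + ∑[ t < k ] g (j ℕ.+ t)                        ≡⟨ cong (_+_ (∑< j f)) (sym (ℤ.+-identityˡ _)) ⟩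
    ∑< j f + (0ℤ + ∑[ t < k ] g (j ℕ.+ t))                 ≡⟨ cong (λ s → ∑< j f + (s + ∑[ t < k ] g (j ℕ.+ t))) (sym (∑<-zero j discarded)) ⟩
    ∑< j f + (∑< j g + ∑[ t < k ] g (j ℕ.+ t))             ≡⟨ cong (_+_ (∑< j f)) (sym (∑<-++ j k g)) ⟩
    ∑< j f + ∑< (j ℕ.+ k) g                                ∎
    where
    open ≡-Reasoning
    g : ℕ → ℤ
    g i = 𝟙 (j ≤? i) * f i
    selected : ∀ t → g (j ℕ.+ t) ≡ f (j ℕ.+ t)
    selected t = trans (cong (_* f (j ℕ.+ t)) (𝟙-yes (j ≤? j ℕ.+ t) (ℕ.m≤m+n j t))) (ℤ.*-identityˡ _)
    discarded : ∀ i → i < j → g i ≡ 0ℤ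
    discarded i i<j = trans (cong (_* f i) (𝟙-no (j ≤? i) (ℕ.<⇒≱ i<j))) (ℤ.*-zeroˡ (f i))

  ∑<-𝟙≟ : ∀ n j (f : ℕ → ℤ) → ∑[ i < n ] (f i * 𝟙 (i ≟ j)) ≡ 𝟙 (j <? n) * f j
  ∑<-𝟙≟ zero    j f = refl
  ∑<-𝟙≟ (suc n) j f = trans (cong (_+ f n * 𝟙 (n ≟ j)) (∑<-𝟙≟ n j f)) (last-term (ℕ.<-cmp j n))
    where
    earlier : ∀ a b → 1ℤ * a + b * 0ℤ ≡ 1ℤ * a
    earlier = solve-∀
    now : ∀ a → 0ℤ * a + a * 1ℤ ≡ 1ℤ * a
    now = solve-∀
    never : ∀ a b → 0ℤ * a + b * 0ℤ ≡ 0ℤ * a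
    never = solve-∀
    last-term : Tri (j < n) (j ≡ n) (n < j) → 𝟙 (j <? n) * f j + f n * 𝟙 (n ≟ j) ≡ 𝟙 (j <? suc n) * f j
    last-term (tri< j<n j≢n _)
      rewrite 𝟙-yes (j <? n) j<n | 𝟙-no (n ≟ j) (j≢n ∘ sym) | 𝟙-yes (j <? suc n) (ℕ.m<n⇒m<1+n j<n)
      = earlier (f j) (f n)
    last-term (tri≈ j≮n refl _)
      rewrite 𝟙-no (j <? n) j≮n | 𝟙-yes (j ≟ j) refl | 𝟙-yes (j <? suc j) ℕ.≤-refl
      = now (f j)
    last-term (tri> j≮n j≢n n<j)
      rewrite 𝟙-no (j <? n) j≮n | 𝟙-no (n ≟ j) (j≢n ∘ sym) | 𝟙-no (j <? suc n) (ℕ.<⇒≱ n<j ∘ ℕ.≤-pred)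
      = never (f j) (f n)

  ∑<-𝟙≟-count : ∀ n j → ∑[ i < n ] 𝟙 (i ≟ j) ≡ 𝟙 (j <? n)
  ∑<-𝟙≟-count n j = begin
    ∑[ i < n ] 𝟙 (i ≟ j)           ≡⟨ ∑<-cong n (λ i _ → sym (ℤ.*-identityˡ (𝟙 (i ≟ j)))) ⟩
    ∑[ i < n ] (1ℤ * 𝟙 (i ≟ j))    ≡⟨ ∑<-𝟙≟ n j (λ _ → 1ℤ) ⟩
    𝟙 (j <? n) * 1ℤ                ≡⟨ ℤ.*-identityʳ _ ⟩
    𝟙 (j <? n)                     ∎
    where open ≡-Reasoning

  ∑<-multiples : ∀ p m (f : ℕ → ℤ) → .{{_ : NonZero p}} →
                 ∑[ i < p ℕ.* m ] (𝟙 (p ∣? suc i) * f (suc i)) ≡ ∑[ j < m ] f (p ℕ.* suc j)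
  ∑<-multiples p zero    f rewrite ℕ.*-zeroʳ p = refl
  ∑<-multiples p@(suc q) (suc m) f = begin
    ∑< (p ℕ.* suc m) g                                 ≡⟨ cong (λ k → ∑< k g) (trans (ℕ.*-suc p m) (ℕ.+-comm p (p ℕ.* m))) ⟩
    ∑< (p ℕ.* m ℕ.+ p) g                               ≡⟨ ∑<-++ (p ℕ.* m) p g ⟩
    ∑< (p ℕ.* m) g + ∑[ t < p ] g (p ℕ.* m ℕ.+ t)      ≡⟨ cong₂ _+_ (∑<-multiples p m f) (cong₂ _+_ (∑<-zero q skipped) hit) ⟩
    ∑[ j < m ] f (p ℕ.* suc j) + (0ℤ + f (p ℕ.* suc m)) ≡⟨ cong (_+_ (∑[ j < m ] f (p ℕ.* suc j))) (ℤ.+-identityˡ _) ⟩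
    ∑[ j < suc m ] f (p ℕ.* suc j)                     ∎
    where
    open ≡-Reasoning
    g : ℕ → ℤ
    g i = 𝟙 (p ∣? suc i) * f (suc i)
    skipped : ∀ t → t < q → g (p ℕ.* m ℕ.+ t) ≡ 0ℤ
    skipped t t<q = cong (_* f (suc (p ℕ.* m ℕ.+ t))) (𝟙-no (p ∣? _) (λ p∣ → >⇒∤ (s≤s t<q)
      (∣m+n∣m⇒∣n (subst (p ∣_) (sym (ℕ.+-suc (p ℕ.* m) t)) p∣) (m∣m*n m))))
    hit : g (p ℕ.* m ℕ.+ q) ≡ f (p ℕ.* suc m)
    hit = begin
      g (p ℕ.* m ℕ.+ q)                          ≡⟨ cong (λ k → 𝟙 (p ∣? k) * f k) p[m+1] ⟩
      𝟙 (p ∣? p ℕ.* suc m) * f (p ℕ.* suc m)     ≡⟨ cong (_* f (p ℕ.* suc m)) (𝟙-yes (p ∣? _) (m∣m*n (suc m))) ⟩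
      1ℤ * f (p ℕ.* suc m)                       ≡⟨ ℤ.*-identityˡ _ ⟩
      f (p ℕ.* suc m)                            ∎
      where
      p[m+1] : suc (p ℕ.* m ℕ.+ q) ≡ p ℕ.* suc m
      p[m+1] = trans (cong suc (ℕ.+-comm (p ℕ.* m) q)) (sym (ℕ.*-suc p m))

  sumℤ : List ℤ → ℤ
  sumℤ = foldr _+_ 0ℤ

  sumℤ-++ : ∀ xs ys → sumℤ (xs ++ ys) ≡ sumℤ xs + sumℤ ys
  sumℤ-++ []       ys = sym (ℤ.+-identityˡ _)
  sumℤ-++ (x ∷ xs) ys = trans (cong (_+_ x) (sumℤ-++ xs ys)) (sym (ℤ.+-assoc x _ _))

  sumℤ-filter : ∀ {A : Set} {P : Pred A _} (P? : Decidable P) (g : A → ℤ) xs →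
                sumℤ (map g (filter P? xs)) ≡ sumℤ (map (λ x → 𝟙 (P? x) * g x) xs)
  sumℤ-filter P? g []       = refl
  sumℤ-filter P? g (x ∷ xs) with P? x
  ... | yes _ = cong₂ _+_ (sym (ℤ.*-identityˡ (g x))) (sumℤ-filter P? g xs)
  ... | no  _ = trans (sumℤ-filter P? g xs) (sym (ℤ.+-identityˡ _))

  length-filter-𝟙 : ∀ {A : Set} {P : Pred A _} (P? : Decidable P) xs →
                    + length (filter P? xs) ≡ sumℤ (map (𝟙 ∘ P?) xs)
  length-filter-𝟙 P? []       = refl
  length-filter-𝟙 P? (x ∷ xs) with P? x
  ... | yes _ = cong (_+_ 1ℤ) (length-filter-𝟙 P? xs)
  ... | no  _ = trans (length-filter-𝟙 P? xs) (sym (ℤ.+-identityˡ _))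

  sumℤ-concatMap : ∀ {A B : Set} (g : B → ℤ) (F : A → List B) xs →
                   sumℤ (map g (concatMap F xs)) ≡ sumℤ (map (λ x → sumℤ (map g (F x))) xs)
  sumℤ-concatMap g F []       = refl
  sumℤ-concatMap g F (x ∷ xs) = begin
    sumℤ (map g (F x ++ concatMap F xs))                ≡⟨ cong sumℤ (List.map-++ g (F x) _) ⟩
    sumℤ (map g (F x) ++ map g (concatMap F xs))        ≡⟨ sumℤ-++ (map g (F x)) _ ⟩
    sumℤ (map g (F x)) + sumℤ (map g (concatMap F xs))  ≡⟨ cong (_+_ (sumℤ (map g (F x)))) (sumℤ-concatMap g F xs) ⟩
    sumℤ (map (λ x → sumℤ (map g (F x))) (x ∷ xs))      ∎
    where open ≡-Reasoning

  sumℤ-applyUpTo : ∀ (g : ℕ → ℤ) f n → sumℤ (map g (applyUpTo f n)) ≡ ∑[ i < n ] g (f i)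
  sumℤ-applyUpTo g f zero    = refl
  sumℤ-applyUpTo g f (suc n) = trans (cong (_+_ (g (f 0))) (sumℤ-applyUpTo g (f ∘ suc) n)) (sym (∑<-suc n (g ∘ f)))

  sumℤ-upTo : ∀ (g : ℕ → ℤ) n → sumℤ (map g (upTo n)) ≡ ∑[ i < n ] g i
  sumℤ-upTo g = sumℤ-applyUpTo g (λ i → i)

  sumℤ-[1…] : ∀ (g : ℕ → ℤ) n → sumℤ (map g [1… n ]) ≡ ∑[ i < n ] g (suc i)
  sumℤ-[1…] g n = trans (cong (sumℤ ∘ map g) (List.map-applyUpTo (λ i → i) suc n)) (sumℤ-applyUpTo g suc n)

  +-sum-map : ∀ {A : Set} (f : A → ℕ) xs → + sum (map f xs) ≡ sumℤ (map (λ x → + f x) xs)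
  +-sum-map f []       = refl
  +-sum-map f (x ∷ xs) = trans (ℤ.pos-+ (f x) _) (cong (_+_ (+ f x)) (+-sum-map f xs))

  -- The Möbius function

  T-not-does : {P : Set} (p? : Dec P) → T (not (does p?)) ⇔ (¬ P)
  T-not-does (yes p) = mk⇔ (λ ()) (λ ¬p → ¬p p)
  T-not-does (no ¬p) = mk⇔ (λ _ → ¬p) _

  T-injective : ∀ {x y} → T x ⇔ T y → x ≡ y
  T-injective {false} {false} _ = refl
  T-injective {true}  {true}  _ = refl
  T-injective {true}  {false} h = ⊥-elim (Equivalence.to h _)
  T-injective {false} {true}  h = ⊥-elim (Equivalence.from h _)

  ∤⇒nonZero : ∀ {p n} → ¬ p ∣ n → NonZero n
  ∤⇒nonZero {p} {zero}  p∤0 = contradiction (p ∣0) p∤0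
  ∤⇒nonZero {n = suc _} _   = _

  prime⇒≥2 : ∀ {p} → Prime p → 2 ≤ p
  prime⇒≥2 {p} pp = ℕ.nonTrivial⇒n>1 p {{prime⇒nonTrivial pp}}

  ∤⇒coprime : ∀ {p n} → Prime p → ¬ p ∣ n → Coprime n p
  ∤⇒coprime pp p∤n (d∣n , d∣p) with prime⇒irreducible pp d∣p
  ... | inj₁ d≡1 = d≡1
  ... | inj₂ refl = contradiction d∣n p∤n

  ∤⇒coprime-square : ∀ {p k} → Prime p → ¬ p ∣ k → Coprime (k ℕ.* k) p
  ∤⇒coprime-square {k = k} pp p∤k = ∤⇒coprime pp (λ p∣k² → [ p∤k , p∤k ]′ (euclidsLemma k k pp p∣k²))

  ∤-*ˡ-prime : ∀ {p q n} → Prime q → Prime p → q ≢ p → ¬ q ∣ n → ¬ q ∣ p ℕ.* n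
  ∤-*ˡ-prime {p} {q} {n} pq pp q≢p q∤n q∣pn with euclidsLemma p n pq q∣pn
  ... | inj₂ q∣n = q∤n q∣n
  ... | inj₁ q∣p with prime⇒irreducible pp q∣p
  ...   | inj₁ refl = ¬prime[1] pq
  ...   | inj₂ q≡p  = q≢p q≡p

  prime-factor : ∀ n → 2 ≤ n → ∃[ p ] Prime p × p ∣ n
  prime-factor n@(suc _) n≥2 with factorise n
  ... | record { factors = [] ; isFactorisation = n≡1 } = contradiction (sym n≡1) (ℕ.<⇒≢ n≥2)
  ... | record { factors = p ∷ _ ; isFactorisation = n≡Π ; factorsPrime = pp ∷ _ } =
    p , pp , subst (p ∣_) (sym n≡Π) (m∣m*n _)

  SquareFree : ℕ → Set
  SquareFree n = ∀ k → 2 ≤ k → ¬ k ℕ.* k ∣ n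

  squarefree-reflects : ∀ n → .{{_ : NonZero n}} → T (squarefree n) ⇔ SquareFree n
  squarefree-reflects n = mk⇔ sound complete
    where
    sound : T (squarefree n) → SquareFree n
    sound sf k@(suc (suc i)) (s≤s (s≤s _)) k²∣n =
      Equivalence.to (T-not-does (k ℕ.* k ∣? n)) (applyUpTo⁻ (λ i → i) n (all⁺ _ (upTo n) sf) i<n) k²∣n
      where
      i<n : i < n
      i<n = ℕ.<-≤-trans (ℕ.m<n+m i (s≤s z≤n)) (ℕ.≤-trans (ℕ.m≤m*n k k) (∣⇒≤ k²∣n))
    complete : SquareFree n → T (squarefree n)
    complete sf = all⁻ _ (applyUpTo⁺₁ (λ i → i) n (λ _ → Equivalence.from (T-not-does (_ ∣? n)) (sf _ (s≤s (s≤s z≤n)))))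

  squareFree-p* : ∀ {p n} → Prime p → ¬ p ∣ n → SquareFree (p ℕ.* n) ⇔ SquareFree n
  squareFree-p* {p} {n} pp p∤n = mk⇔ to from
    where
    instance _ = prime⇒nonZero pp
    to : SquareFree (p ℕ.* n) → SquareFree n
    to sf k k≥2 k²∣n = sf k k≥2 (∣-trans k²∣n (n∣m*n p))
    from : SquareFree n → SquareFree (p ℕ.* n)
    from sf k k≥2 k²∣pn with p ∣? k
    ... | no  p∤k = sf k k≥2 (coprime-divisor (∤⇒coprime-square pp p∤k) k²∣pn)
    ... | yes p∣k = p∤n (*-cancelˡ-∣ p (∣-trans (*-pres-∣ p∣k p∣k) k²∣pn))

  squarefree-p*-coprime : ∀ {p n} → Prime p → ¬ p ∣ n → squarefree (p ℕ.* n) ≡ squarefree n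
  squarefree-p*-coprime {p} {n} pp p∤n = T-injective
    (⇔.trans (squarefree-reflects (p ℕ.* n)) (⇔.trans (squareFree-p* pp p∤n) (⇔.sym (squarefree-reflects n))))
    where instance
      _ = ∤⇒nonZero p∤n
      _ = ℕ.m*n≢0 p n {{prime⇒nonZero pp}}

  squarefree-p*-dvd : ∀ {p n} → Prime p → p ∣ n → .{{_ : NonZero n}} → squarefree (p ℕ.* n) ≡ false
  squarefree-p*-dvd {p} {n} pp p∣n with squarefree (p ℕ.* n) in eq
  ... | false = refl
  ... | true  = contradiction (*-monoʳ-∣ p p∣n)
                  (Equivalence.to (squarefree-reflects (p ℕ.* n)) (subst T (sym eq) _) p (prime⇒≥2 pp))
    where instance _ = ℕ.m*n≢0 p n {{prime⇒nonZero pp}}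

  +ω≡∑ : ∀ n → + ω n ≡ ∑[ i < n ] 𝟙 (prime? (suc i) ×-dec suc i ∣? n)
  +ω≡∑ n = trans (length-filter-𝟙 _ [1… n ]) (sumℤ-[1…] _ n)

  𝟙-primeDivisor-p* : ∀ {p n} → Prime p → ¬ p ∣ n → ∀ q →
                      𝟙 (prime? q ×-dec q ∣? p ℕ.* n) ≡ 𝟙 (prime? q ×-dec q ∣? n) + 𝟙 (q ≟ p)
  𝟙-primeDivisor-p* {p} {n} pp p∤n q with prime? q | q ∣? n | q ≟ p
  ... | no ¬pq | _       | no _     = refl
  ... | no ¬pq | _       | yes refl = contradiction pp ¬pq
  ... | yes pq | yes q∣n | no _     = 𝟙-yes (yes pq ×-dec q ∣? p ℕ.* n) (pq , ∣n⇒∣m*n p q∣n)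
  ... | yes _  | yes q∣n | yes refl = contradiction q∣n p∤n
  ... | yes pq | no _    | yes refl = 𝟙-yes (yes pq ×-dec q ∣? q ℕ.* n) (pq , m∣m*n n)
  ... | yes pq | no q∤n  | no q≢p   = 𝟙-no (yes pq ×-dec q ∣? p ℕ.* n) (∤-*ˡ-prime pq pp q≢p q∤n ∘ proj₂)

  ω-p* : ∀ {p n} → Prime p → ¬ p ∣ n → ω (p ℕ.* n) ≡ suc (ω n)
  ω-p* {p@(suc p-1)} {n} pp p∤n = trans (ℤ.+-injective counted) (ℕ.+-comm (ω n) 1)
    where
    instance _ = ∤⇒nonZero p∤n
    N = p ℕ.* n
    n≤N : n ≤ N
    n≤N = ℕ.m≤n*m n p
    primes-of-n : ∑[ i < N ] 𝟙 (prime? (suc i) ×-dec suc i ∣? n) ≡ + ω n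
    primes-of-n = trans (∑<-extend _ n≤N (λ i n≤i _ → 𝟙-no (prime? (suc i) ×-dec suc i ∣? n) (>⇒∤ (s≤s n≤i) ∘ proj₂))) (sym (+ω≡∑ n))
    just-p : ∑[ i < N ] 𝟙 (suc i ≟ p) ≡ 1ℤ
    just-p = begin
      ∑[ i < N ] 𝟙 (suc i ≟ p)   ≡⟨ ∑<-cong N (λ i _ → 𝟙-suc≟suc i p-1) ⟩
      ∑[ i < N ] 𝟙 (i ≟ p-1)     ≡⟨ ∑<-𝟙≟-count N p-1 ⟩
      𝟙 (p-1 <? N)               ≡⟨ 𝟙-yes (p-1 <? N) (ℕ.<-≤-trans ℕ.≤-refl (ℕ.m≤m*n p n)) ⟩
      1ℤ                         ∎
      where open ≡-Reasoning
    counted : + ω N ≡ + ω n + 1ℤ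
    counted = begin
      + ω N                                                                   ≡⟨ +ω≡∑ N ⟩
      ∑[ i < N ] 𝟙 (prime? (suc i) ×-dec suc i ∣? N)                          ≡⟨ ∑<-cong N (λ i _ → 𝟙-primeDivisor-p* pp p∤n (suc i)) ⟩
      ∑[ i < N ] (𝟙 (prime? (suc i) ×-dec suc i ∣? n) + 𝟙 (suc i ≟ p))        ≡⟨ ∑<-+ N _ _ ⟩
      ∑[ i < N ] 𝟙 (prime? (suc i) ×-dec suc i ∣? n) + ∑[ i < N ] 𝟙 (suc i ≟ p) ≡⟨ cong₂ _+_ primes-of-n just-p ⟩
      + ω n + 1ℤ                                                              ∎
      where open ≡-Reasoning

  μ-p*-coprime : ∀ {p n} → Prime p → ¬ p ∣ n → μ (p ℕ.* n) ≡ - μ n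
  μ-p*-coprime {p} {n} pp p∤n rewrite squarefree-p*-coprime pp p∤n | ω-p* pp p∤n with squarefree n
  ... | true  = ℤ.-1*i≡-i _
  ... | false = refl

  μ-p*-dvd : ∀ {p n} → Prime p → p ∣ n → .{{_ : NonZero n}} → μ (p ℕ.* n) ≡ 0ℤ
  μ-p*-dvd pp p∣n {{n≢0}} rewrite squarefree-p*-dvd pp p∣n {{n≢0}} = refl

  -- Sums over the divisors d of n run over d = suc i with i < n.
  μ[_∣_] : ℕ → ℕ → ℤ
  μ[ d ∣ n ] = 𝟙 (d ∣? n) * μ d

  μ[∣p*]-split : ∀ {p} m → Prime p → ∀ d →
                 μ[ d ∣ p ℕ.* m ] ≡ 𝟙 (¬? (p ∣? d)) * μ[ d ∣ m ] + 𝟙 (p ∣? d) * μ[ d ∣ p ℕ.* m ]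
  μ[∣p*]-split {p} m pp d with p ∣? d
  ... | yes _   = only-second μ[ d ∣ p ℕ.* m ] μ[ d ∣ m ]
    where
    only-second : ∀ x y → x ≡ 0ℤ * y + 1ℤ * x
    only-second = solve-∀
  ... | no  p∤d = trans (cong (_* μ d) (𝟙-cong (d ∣? p ℕ.* m) (d ∣? m) (coprime-divisor (∤⇒coprime pp p∤d)) (∣n⇒∣m*n p)))
                        (only-first μ[ d ∣ m ] μ[ d ∣ p ℕ.* m ])
    where
    only-first : ∀ x y → x ≡ 1ℤ * x + 0ℤ * y
    only-first = solve-∀

  μ[p*∣p*] : ∀ {p} m → Prime p → ∀ d → .{{_ : NonZero d}} → μ[ p ℕ.* d ∣ p ℕ.* m ] ≡ - (𝟙 (¬? (p ∣? d)) * μ[ d ∣ m ])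
  μ[p*∣p*] {p} m pp d with p ∣? d
  ... | yes p∣d = trans (cong (𝟙 (p ℕ.* d ∣? p ℕ.* m) *_) (μ-p*-dvd pp p∣d)) (vanishes (𝟙 (p ℕ.* d ∣? p ℕ.* m)) μ[ d ∣ m ])
    where
    vanishes : ∀ x y → x * 0ℤ ≡ - (0ℤ * y)
    vanishes = solve-∀
  ... | no  p∤d = trans (cong₂ _*_ (𝟙-cong (p ℕ.* d ∣? p ℕ.* m) (d ∣? m) (*-cancelˡ-∣ p {{prime⇒nonZero pp}}) (*-monoʳ-∣ p))
                                   (μ-p*-coprime pp p∤d))
                        (negated (𝟙 (d ∣? m)) (μ d))
    where
    negated : ∀ x y → x * - y ≡ - (1ℤ * (x * y))
    negated = solve-∀

  -- The divisors of p m prime to p cancel against their multiples by p.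
  ∑μ-divisors-p* : ∀ p m → Prime p → .{{_ : NonZero m}} → ∑[ i < p ℕ.* m ] μ[ suc i ∣ p ℕ.* m ] ≡ 0ℤ
  ∑μ-divisors-p* p m pp = begin
    ∑[ i < N ] μ[ suc i ∣ N ]                                           ≡⟨ ∑<-cong N (λ i _ → μ[∣p*]-split m pp (suc i)) ⟩
    ∑[ i < N ] (A (suc i) + 𝟙 (p ∣? suc i) * μ[ suc i ∣ N ])            ≡⟨ ∑<-+ N _ _ ⟩
    ∑[ i < N ] A (suc i) + ∑[ i < N ] (𝟙 (p ∣? suc i) * μ[ suc i ∣ N ]) ≡⟨ cong₂ _+_ prime-to-p (∑<-multiples p m μ[_∣ N ]) ⟩
    ∑[ i < m ] A (suc i) + ∑[ j < m ] μ[ p ℕ.* suc j ∣ N ]              ≡⟨ cong (_+_ (∑[ i < m ] A (suc i))) multiples-of-p ⟩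
    ∑[ i < m ] A (suc i) - ∑[ i < m ] A (suc i)                         ≡⟨ ℤ.+-inverseʳ (∑[ i < m ] A (suc i)) ⟩
    0ℤ                                                                  ∎
    where
    open ≡-Reasoning
    instance _ = prime⇒nonZero pp
    N = p ℕ.* m
    A : ℕ → ℤ
    A d = 𝟙 (¬? (p ∣? d)) * μ[ d ∣ m ]
    zero-middle : ∀ x y → x * (0ℤ * y) ≡ 0ℤ
    zero-middle = solve-∀
    prime-to-p : ∑[ i < N ] A (suc i) ≡ ∑[ i < m ] A (suc i)
    prime-to-p = ∑<-extend _ (ℕ.m≤n*m m p) (λ i m≤i _ →
      trans (cong (λ c → 𝟙 (¬? (p ∣? suc i)) * (c * μ (suc i))) (𝟙-no (suc i ∣? m) (>⇒∤ (s≤s m≤i))))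
            (zero-middle (𝟙 (¬? (p ∣? suc i))) (μ (suc i))))
    multiples-of-p : ∑[ j < m ] μ[ p ℕ.* suc j ∣ N ] ≡ - ∑[ i < m ] A (suc i)
    multiples-of-p = trans (∑<-cong m (λ j _ → μ[p*∣p*] m pp (suc j))) (∑<-neg m _)

  ∑μ-divisors : ∀ n → .{{_ : NonZero n}} → ∑[ i < n ] μ[ suc i ∣ n ] ≡ 𝟙 (n ≟ 1)
  ∑μ-divisors (suc zero) = refl
  ∑μ-divisors n@(suc (suc _)) with p , pp , p∣n ← prime-factor n (s≤s (s≤s z≤n)) =
    subst (λ k → ∑[ i < k ] μ[ suc i ∣ k ] ≡ 0ℤ) (sym (m∣n⇒n≡m*quotient p∣n))
          (∑μ-divisors-p* p (quotient p∣n) pp {{quotient≢0 p∣n}})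

  ∑μ-common-divisors : ∀ x h → .{{_ : NonZero h}} → ∑[ i < h ] (𝟙 (suc i ∣? h) * μ[ suc i ∣ x ]) ≡ 𝟙 (coprime? x h)
  ∑μ-common-divisors x h = begin
    ∑[ i < h ] (𝟙 (suc i ∣? h) * μ[ suc i ∣ x ])  ≡⟨ ∑<-cong h (λ i _ → common-divisor (suc i)) ⟩
    ∑[ i < h ] μ[ suc i ∣ g ]                     ≡⟨ ∑<-extend _ (gcd[m,n]≤n x h) beyond-g ⟩
    ∑[ i < g ] μ[ suc i ∣ g ]                     ≡⟨ ∑μ-divisors g ⟩
    𝟙 (g ≟ 1)                                     ≡⟨ 𝟙-cong (g ≟ 1) (coprime? x h) gcd≡1⇒coprime coprime⇒gcd≡1 ⟩
    𝟙 (coprime? x h)                              ∎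
    where
    open ≡-Reasoning
    g = gcd x h
    instance _ = ℕ.≢-nonZero (gcd[m,n]≢0 x h (inj₂ (ℕ.≢-nonZero⁻¹ h)))
    common-divisor : ∀ d → 𝟙 (d ∣? h) * μ[ d ∣ x ] ≡ μ[ d ∣ g ]
    common-divisor d = begin
      𝟙 (d ∣? h) * (𝟙 (d ∣? x) * μ d)   ≡⟨ ℤ.*-assoc (𝟙 (d ∣? h)) _ _ ⟨
      𝟙 (d ∣? h) * 𝟙 (d ∣? x) * μ d     ≡⟨ cong (_* μ d) (𝟙-* (d ∣? h) (d ∣? x)) ⟩
      𝟙 (d ∣? h ×-dec d ∣? x) * μ d     ≡⟨ cong (_* μ d) (𝟙-cong (d ∣? h ×-dec d ∣? x) (d ∣? g)
                                              (λ (d∣h , d∣x) → gcd-greatest d∣x d∣h)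
                                              (λ d∣g → ∣-trans d∣g (gcd[m,n]∣n x h) , ∣-trans d∣g (gcd[m,n]∣m x h))) ⟩
      𝟙 (d ∣? g) * μ d                  ∎
    beyond-g : ∀ i → g ≤ i → i < h → μ[ suc i ∣ g ] ≡ 0ℤ
    beyond-g i g≤i _ = cong (_* μ (suc i)) (𝟙-no (suc i ∣? g) (>⇒∤ (s≤s g≤i)))

  -- Integers up to N coprime to h

  +[1+N]/d : ∀ (N d : ℕ) → .{{_ : NonZero d}} → + (suc N ℕ./ d) ≡ + (N ℕ./ d) + 𝟙 (d ∣? suc N)
  +[1+N]/d N d with ℕ.m≤n⇒m<n∨m≡n (ℕ.m%n<n N d)
  ... | inj₁ 1+r<d = begin
    + (suc N ℕ./ d)                ≡⟨ cong (λ k → + (k ℕ./ d)) 1+N≡1+r+qd ⟩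
    + ((suc r ℕ.+ q ℕ.* d) ℕ./ d)  ≡⟨ cong +_ (ℕ.+-distrib-/ (suc r) (q ℕ.* d) no-carry) ⟩
    + (suc r ℕ./ d ℕ.+ q ℕ.* d ℕ./ d)  ≡⟨ cong₂ (λ a b → + (a ℕ.+ b)) (ℕ.m<n⇒m/n≡0 1+r<d) (ℕ.m*n/n≡m q d) ⟩
    + q                            ≡⟨ ℤ.+-identityʳ (+ q) ⟨
    + q + 0ℤ                       ≡⟨ cong (_+_ (+ q)) (𝟙-no (d ∣? suc N) d∤1+N) ⟨
    + q + 𝟙 (d ∣? suc N)           ∎
    where
    open ≡-Reasoning
    q = N ℕ./ d
    r = N ℕ.% d
    1+N≡1+r+qd : suc N ≡ suc r ℕ.+ q ℕ.* d
    1+N≡1+r+qd = cong suc (ℕ.m≡m%n+[m/n]*n N d)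
    no-carry : suc r ℕ.% d ℕ.+ q ℕ.* d ℕ.% d < d
    no-carry = subst (_< d) (sym (trans (cong₂ ℕ._+_ (ℕ.m<n⇒m%n≡m 1+r<d) (ℕ.m*n%n≡0 q d)) (ℕ.+-identityʳ (suc r)))) 1+r<d
    d∤1+N : ¬ d ∣ suc N
    d∤1+N d∣1+N = >⇒∤ 1+r<d (∣m+n∣m⇒∣n (subst (d ∣_) (trans 1+N≡1+r+qd (ℕ.+-comm (suc r) _)) d∣1+N) (n∣m*n q))
  ... | inj₂ 1+r≡d = begin
    + (suc N ℕ./ d)           ≡⟨ cong (λ k → + (k ℕ./ d)) 1+N≡[1+q]d ⟩
    + (suc q ℕ.* d ℕ./ d)     ≡⟨ cong +_ (ℕ.m*n/n≡m (suc q) d) ⟩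
    + suc q                   ≡⟨ cong +_ (ℕ.+-comm 1 q) ⟩
    + q + 1ℤ                  ≡⟨ cong (_+_ (+ q)) (𝟙-yes (d ∣? suc N) (divides (suc q) 1+N≡[1+q]d)) ⟨
    + q + 𝟙 (d ∣? suc N)      ∎
    where
    open ≡-Reasoning
    q = N ℕ./ d
    1+N≡[1+q]d : suc N ≡ suc q ℕ.* d
    1+N≡[1+q]d = trans (cong suc (ℕ.m≡m%n+[m/n]*n N d)) (cong (ℕ._+ q ℕ.* d) 1+r≡d)

  coprimeCount : ℕ → ℕ → ℤ
  coprimeCount N h = ∑[ b < N ] 𝟙 (coprime? (suc b) h)

  coprimeCount-μ : ∀ N h → .{{_ : NonZero h}} →
                   coprimeCount N h ≡ ∑[ i < h ] (𝟙 (suc i ∣? h) * (μ (suc i) * + (N ℕ./ suc i)))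
  coprimeCount-μ zero    h = sym (∑<-zero h (λ i _ → no-multiples (𝟙 (suc i ∣? h)) (μ (suc i))))
    where
    no-multiples : ∀ a b → a * (b * 0ℤ) ≡ 0ℤ
    no-multiples = solve-∀
  coprimeCount-μ (suc N) h = begin
    coprimeCount N h + 𝟙 (coprime? (suc N) h)
      ≡⟨ cong₂ _+_ (coprimeCount-μ N h) (sym (∑μ-common-divisors (suc N) h)) ⟩
    ∑[ i < h ] (𝟙 (suc i ∣? h) * (μ (suc i) * + (N ℕ./ suc i)))
      + ∑[ i < h ] (𝟙 (suc i ∣? h) * μ[ suc i ∣ suc N ])
      ≡⟨ ∑<-+ h _ _ ⟨
    ∑[ i < h ] (𝟙 (suc i ∣? h) * (μ (suc i) * + (N ℕ./ suc i)) + 𝟙 (suc i ∣? h) * μ[ suc i ∣ suc N ])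
      ≡⟨ ∑<-cong h (λ i _ → one-more (suc i)) ⟩
    ∑[ i < h ] (𝟙 (suc i ∣? h) * (μ (suc i) * + (suc N ℕ./ suc i)))
      ∎
    where
    open ≡-Reasoning
    factor : ∀ a b c x → a * (b * c) + a * (x * b) ≡ a * (b * (c + x))
    factor = solve-∀
    one-more : ∀ d → .{{_ : NonZero d}} →
               𝟙 (d ∣? h) * (μ d * + (N ℕ./ d)) + 𝟙 (d ∣? h) * μ[ d ∣ suc N ] ≡ 𝟙 (d ∣? h) * (μ d * + (suc N ℕ./ d))
    one-more d = trans (factor (𝟙 (d ∣? h)) (μ d) (+ (N ℕ./ d)) (𝟙 (d ∣? suc N)))
                       (cong (λ k → 𝟙 (d ∣? h) * (μ d * k)) (sym (+[1+N]/d N d)))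

  coprimeCount-divisors : ∀ N h → .{{_ : NonZero h}} →
    coprimeCount N h ≡ sumℤ (map (λ e → μ (suc e) * + (N ℕ./ suc e)) (filter (λ e → suc e ∣? h) (upTo h)))
  coprimeCount-divisors N h = trans (coprimeCount-μ N h) (sym (trans (sumℤ-filter _ _ (upTo h)) (sumℤ-upTo _ h)))

  -- Farey fractions with a given numerator

  𝒩≡∑ : ∀ n j → + 𝒩 n (suc j) ≡ ∑[ b < n ] (𝟙 (j ≤? b) * 𝟙 (coprime? (suc b) (suc j)))
  𝒩≡∑ n j = begin
    + 𝒩 n h                                                      ≡⟨ length-filter-𝟙 Q? (Farey n) ⟩
    sumℤ (map (𝟙 ∘ Q?) (concatMap fractions [1… n ]))            ≡⟨ sumℤ-concatMap (𝟙 ∘ Q?) fractions [1… n ] ⟩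
    sumℤ (map (λ b → sumℤ (map (𝟙 ∘ Q?) (fractions b))) [1… n ]) ≡⟨ sumℤ-[1…] _ n ⟩
    ∑[ b < n ] sumℤ (map (𝟙 ∘ Q?) (fractions (suc b)))           ≡⟨ ∑<-cong n (λ b _ → with-denominator b) ⟩
    ∑[ b < n ] (𝟙 (j ≤? b) * 𝟙 (coprime? (suc b) h))            ∎
    where
    open ≡-Reasoning
    h = suc j
    Q? = λ (p : ℕ × ℕ) → proj₁ p ≟ h
    fractions : ℕ → List (ℕ × ℕ)
    fractions b = map (λ a → (a , b)) (filter (λ a → coprime? a b) [1… b ])
    with-denominator : ∀ b → sumℤ (map (𝟙 ∘ Q?) (fractions (suc b))) ≡ 𝟙 (j ≤? b) * 𝟙 (coprime? (suc b) h)
    with-denominator b = begin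
      sumℤ (map (𝟙 ∘ Q?) (fractions B))                                ≡⟨ cong sumℤ (List.map-∘ (filter (λ a → coprime? a B) [1… B ])) ⟨
      sumℤ (map (λ a → 𝟙 (a ≟ h)) (filter (λ a → coprime? a B) [1… B ])) ≡⟨ sumℤ-filter (λ a → coprime? a B) _ [1… B ] ⟩
      sumℤ (map (λ a → 𝟙 (coprime? a B) * 𝟙 (a ≟ h)) [1… B ])          ≡⟨ sumℤ-[1…] (λ a → 𝟙 (coprime? a B) * 𝟙 (a ≟ h)) B ⟩
      ∑[ i < B ] (𝟙 (coprime? (suc i) B) * 𝟙 (suc i ≟ h))              ≡⟨ ∑<-cong B (λ i _ → cong (𝟙 (coprime? (suc i) B) *_) (𝟙-suc≟suc i j)) ⟩
      ∑[ i < B ] (𝟙 (coprime? (suc i) B) * 𝟙 (i ≟ j))                   ≡⟨ ∑<-𝟙≟ B j (λ i → 𝟙 (coprime? (suc i) B)) ⟩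
      𝟙 (j <? B) * 𝟙 (coprime? h B)                                     ≡⟨ cong₂ _*_ (𝟙-cong (j <? B) (j ≤? b) ℕ.≤-pred s≤s)
                                                                                    (𝟙-cong (coprime? h B) (coprime? B h) Coprime.sym Coprime.sym) ⟩
      𝟙 (j ≤? b) * 𝟙 (coprime? B h)                                     ∎
      where B = suc b

  +φ≡coprimeCount : ∀ h → + φ h ≡ coprimeCount h h
  +φ≡coprimeCount h = trans (length-filter-𝟙 _ [1… h ]) (sumℤ-[1…] _ h)

  𝟙-coprime-self : ∀ h → 𝟙 (coprime? h h) ≡ 𝟙 (h ≟ 1)
  𝟙-coprime-self h = 𝟙-cong (coprime? h h) (h ≟ 1) (λ c → c (∣-refl , ∣-refl)) (λ { refl → Coprime.1-coprimeTo 1 })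

  𝒩+φ : ∀ n j → j < n → + 𝒩 n (suc j) + + φ (suc j) ≡ coprimeCount n (suc j) + 𝟙 (suc j ≟ 1)
  𝒩+φ n j j<n = begin
    + 𝒩 n h + + φ h                                         ≡⟨ cong₂ _+_ (𝒩≡∑ n j) (+φ≡coprimeCount h) ⟩
    later + (coprimeCount j h + 𝟙 (coprime? h h))          ≡⟨ cong (λ c → later + (coprimeCount j h + c)) (𝟙-coprime-self h) ⟩
    later + (coprimeCount j h + 𝟙 (h ≟ 1))                 ≡⟨ rearrange later (coprimeCount j h) (𝟙 (h ≟ 1)) ⟩
    coprimeCount j h + later + 𝟙 (h ≟ 1)                   ≡⟨ cong (_+ 𝟙 (h ≟ 1)) (∑<-split-at _ (ℕ.<⇒≤ j<n)) ⟨
    coprimeCount n h + 𝟙 (h ≟ 1)                           ∎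
    where
    open ≡-Reasoning
    h = suc j
    later = ∑[ b < n ] (𝟙 (j ≤? b) * 𝟙 (coprime? (suc b) h))
    rearrange : ∀ a b c → a + (b + c) ≡ b + a + c
    rearrange = solve-∀

  ∑𝒩+Φ : ∀ m n → 0 < m → m < n →
                + sum (map (λ k → 𝒩 n (suc k)) (upTo m)) + + Φ m ≡ ∑[ k < m ] coprimeCount n (suc k) + 1ℤ
  ∑𝒩+Φ m n 0<m m<n = begin
    + sum (map (λ k → 𝒩 n (suc k)) (upTo m)) + + Φ m
      ≡⟨ cong₂ _+_ (trans (+-sum-map _ (upTo m)) (sumℤ-upTo _ m)) (trans (+-sum-map φ [1… m ]) (sumℤ-[1…] _ m)) ⟩
    ∑[ k < m ] (+ 𝒩 n (suc k)) + ∑[ k < m ] (+ φ (suc k))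
      ≡⟨ ∑<-+ m _ _ ⟨
    ∑[ k < m ] (+ 𝒩 n (suc k) + + φ (suc k))
      ≡⟨ ∑<-cong m (λ k k<m → 𝒩+φ n k (ℕ.<-trans k<m m<n)) ⟩
    ∑[ k < m ] (coprimeCount n (suc k) + 𝟙 (suc k ≟ 1))
      ≡⟨ ∑<-+ m _ _ ⟩
    ∑[ k < m ] coprimeCount n (suc k) + ∑[ k < m ] 𝟙 (suc k ≟ 1)
      ≡⟨ cong (_+_ (∑[ k < m ] coprimeCount n (suc k))) only-h≡1 ⟩
    ∑[ k < m ] coprimeCount n (suc k) + 1ℤ
      ∎
    where
    open ≡-Reasoning
    only-h≡1 : ∑[ k < m ] 𝟙 (suc k ≟ 1) ≡ 1ℤ
    only-h≡1 = trans (∑<-cong m (λ k _ → 𝟙-suc≟suc k 0)) (trans (∑<-𝟙≟-count m 0) (𝟙-yes (0 <? m) 0<m))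

-- The formula over ℚ

open import Data.Rational as ℚ using (ℚ; 0ℚ; 1ℚ; _/_; _+_; _-_; _*_; floor; toℚᵘ; mkℚ+)
import Data.Rational.Properties as ℚ
open import Data.Rational.Unnormalised as ℚᵘ using (mkℚᵘ; *≡*)
import Data.Rational.Unnormalised.Properties as ℚᵘ
open import Data.Rational.Solver using (module +-*-Solver)

/-cross : ∀ i j d e .{{_ : NonZero d}} .{{_ : NonZero e}} → i ℤ.* + e ≡ j ℤ.* + d → i / d ≡ j / e
/-cross i j (suc d) (suc e) eq = ℚ.fromℚᵘ-cong {mkℚᵘ i d} {mkℚᵘ j e} (*≡* eq)

toℚᵘ-/ : ∀ i d .{{_ : NonZero d}} → toℚᵘ (i / d) ℚᵘ.≃ (i ℚᵘ./ d)
toℚᵘ-/ i (suc d) = ℚ.toℚᵘ-fromℚᵘ (mkℚᵘ i d)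

/-*-/ : ∀ i j d e → (i / suc d) * (j / suc e) ≡ (i ℤ.* j) / (suc d ℕ.* suc e)
/-*-/ i j d e = ℚ.toℚᵘ-injective (begin
  toℚᵘ (i / suc d * (j / suc e))          ≈⟨ ℚ.toℚᵘ-homo-* (i / suc d) (j / suc e) ⟩
  toℚᵘ (i / suc d) ℚᵘ.* toℚᵘ (j / suc e)  ≈⟨ ℚᵘ.*-cong (toℚᵘ-/ i (suc d)) (toℚᵘ-/ j (suc e)) ⟩
  (i ℚᵘ./ suc d) ℚᵘ.* (j ℚᵘ./ suc e)     ≈⟨ toℚᵘ-/ (i ℤ.* j) (suc d ℕ.* suc e) ⟨
  toℚᵘ ((i ℤ.* j) / (suc d ℕ.* suc e))   ∎)
  where open ℚᵘ.≃-Reasoning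

/-+-/ : ∀ i j d e → (i / suc d) + (j / suc e) ≡ (i ℤ.* + suc e ℤ.+ j ℤ.* + suc d) / (suc d ℕ.* suc e)
/-+-/ i j d e = ℚ.toℚᵘ-injective (begin
  toℚᵘ (i / suc d + j / suc e)            ≈⟨ ℚ.toℚᵘ-homo-+ (i / suc d) (j / suc e) ⟩
  toℚᵘ (i / suc d) ℚᵘ.+ toℚᵘ (j / suc e)  ≈⟨ ℚᵘ.+-cong (toℚᵘ-/ i (suc d)) (toℚᵘ-/ j (suc e)) ⟩
  (i ℚᵘ./ suc d) ℚᵘ.+ (j ℚᵘ./ suc e)     ≈⟨ toℚᵘ-/ (i ℤ.* + suc e ℤ.+ j ℤ.* + suc d) (suc d ℕ.* suc e) ⟨
  toℚᵘ ((i ℤ.* + suc e ℤ.+ j ℤ.* + suc d) / (suc d ℕ.* suc e)) ∎)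
  where open ℚᵘ.≃-Reasoning

/1-+ : ∀ a b → (a ℤ.+ b) / 1 ≡ a / 1 + b / 1
/1-+ a b = trans (/-cross (a ℤ.+ b) (a ℤ.* 1ℤ ℤ.+ b ℤ.* 1ℤ) 1 1 (cong (ℤ._* 1ℤ) (cong₂ ℤ._+_ (sym (ℤ.*-identityʳ a)) (sym (ℤ.*-identityʳ b))))) (sym (/-+-/ a b 0 0))

/1-* : ∀ a b → (a ℤ.* b) / 1 ≡ a / 1 * (b / 1)
/1-* a b = sym (/-*-/ a b 0 0)

/-as-* : ∀ i d → i / suc d ≡ i / 1 * (+ 1 / suc d)
/-as-* i d = trans (/-cross i (i ℤ.* + 1) (suc d) (1 ℕ.* suc d) (cong₂ ℤ._*_ (sym (ℤ.*-identityʳ i)) (cong +_ (ℕ.*-identityˡ (suc d))))) (sym (/-*-/ i (+ 1) 0 d))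

quotient-/ : ∀ h d .{{_ : NonZero d}} → d ∣ suc h → (+ (suc h ℕ./ d)) / 1 * (+ 1 / suc h) ≡ + 1 / d
quotient-/ h d d∣h = trans (/-*-/ (+ q) (+ 1) 0 h) (/-cross (+ q ℤ.* + 1) (+ 1) (1 ℕ.* suc h) d (begin
  + q ℤ.* + 1 ℤ.* + d    ≡⟨ cong (ℤ._* + d) (ℤ.*-identityʳ (+ q)) ⟩
  + q ℤ.* + d            ≡⟨ ℤ.pos-* q d ⟨
  + (q ℕ.* d)            ≡⟨ cong +_ (trans (ℕ.m/n*n≡m d∣h) (sym (trans (ℕ.*-identityˡ (1 ℕ.* suc h)) (ℕ.*-identityˡ (suc h))))) ⟩
  + (1 ℕ.* (1 ℕ.* suc h)) ≡⟨ ℤ.pos-* 1 (1 ℕ.* suc h) ⟩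
  + 1 ℤ.* + (1 ℕ.* suc h) ∎))
  where
  open ≡-Reasoning
  q = suc h ℕ./ d

floor-mkℚ+ : ∀ a d .{{_ : NonZero d}} .{c : Coprime a d} → floor (mkℚ+ a d c) ≡ + (a ℕ./ d)
floor-mkℚ+ a (suc _) = ℤ.*-identityˡ _

floor-/ : ∀ n d .{{_ : NonZero d}} → floor (+ n / d) ≡ + (n ℕ./ d)
floor-/ n d = trans (floor-mkℚ+ (n ℕ./ g) (d ℕ./ g)) (cong +_ cancel-gcd)
  where
  g = gcd n d
  instance
    _ = ℕ.≢-nonZero (gcd[m,n]≢0 n d (inj₂ (ℕ.≢-nonZero⁻¹ d)))
    _ = ℕ.≢-nonZero (n/gcd[m,n]≢0 n d)
    _ = ℕ.m*n≢0 (d ℕ./ g) g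
  cancel-gcd : (n ℕ./ g) ℕ./ (d ℕ./ g) ≡ n ℕ./ d
  cancel-gcd = begin
    (n ℕ./ g) ℕ./ (d ℕ./ g)                   ≡⟨ ℕ.m*n/o*n≡m/o (n ℕ./ g) g (d ℕ./ g) ⟨
    (n ℕ./ g ℕ.* g) ℕ./ (d ℕ./ g ℕ.* g)       ≡⟨ ℕ./-congˡ {o = d ℕ./ g ℕ.* g} (ℕ.m/n*n≡m (gcd[m,n]∣m n d)) ⟩
    n ℕ./ (d ℕ./ g ℕ.* g)                     ≡⟨ ℕ./-congʳ (ℕ.m/n*n≡m (gcd[m,n]∣n n d)) ⟩
    n ℕ./ d                                   ∎
    where open ≡-Reasoning

/1-sumℚ : ∀ {A : Set} (f : A → ℤ) xs → sumℚ (map (λ x → f x / 1) xs) ≡ sumℤ (map f xs) / 1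
/1-sumℚ f []       = refl
/1-sumℚ f (x ∷ xs) = trans (cong (_+_ (f x / 1)) (/1-sumℚ f xs)) (sym (/1-+ (f x) _))

sumℚ-affine : ∀ {A : Set} a (f g : A → ℚ) xs → sumℚ (map (λ x → a * f x - g x) xs) ≡ a * sumℚ (map f xs) - sumℚ (map g xs)
sumℚ-affine a f g []       = sym (trans (cong (_- 0ℚ) (ℚ.*-zeroʳ a)) (ℚ.+-identityʳ _))
sumℚ-affine a f g (x ∷ xs) = trans (cong (_+_ (a * f x - g x)) (sumℚ-affine a f g xs)) (regroup a (f x) (g x) _ _)
  where
  open +-*-Solver
  regroup : ∀ a b c s t → a * b - c + (a * s - t) ≡ a * (b + s) - (c + t)
  regroup = solve 5 (λ a b c s t → a :* b :- c :+ (a :* s :- t) := a :* (b :+ s) :- (c :+ t)) refl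

divisor-term : ∀ n h d → .{{_ : NonZero d}} → d ∣ suc h →
  (μ d ℤ.* + (n ℕ./ d)) / 1 ≡ + n / 1 * (+ 1 / suc h) * ((μ d ℤ.* + (suc h ℕ./ d)) / 1) - μ d / 1 * frac (+ n / d)
divisor-term n h d@(suc e) d∣h = sym (begin
  X * H * ((μ d ℤ.* + (suc h ℕ./ d)) / 1) - M * frac (+ n / d)
    ≡⟨ cong₂ (λ a b → X * H * a - M * b) (/1-* (μ d) (+ (suc h ℕ./ d))) frac-/ ⟩
  X * H * (M * Q) - M * (X * D - F)
    ≡⟨ cong (λ a → X * H * (M * Q) - M * (X * a - F)) (quotient-/ h d d∣h) ⟨
  X * H * (M * Q) - M * (X * (Q * H) - F)
    ≡⟨ cancel X H Q M F ⟩
  M * F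
    ≡⟨ /1-* (μ d) (+ (n ℕ./ d)) ⟨
  (μ d ℤ.* + (n ℕ./ d)) / 1 ∎)
  where
  open ≡-Reasoning
  open +-*-Solver
  X = + n / 1
  H = + 1 / suc h
  M = μ d / 1
  Q = + (suc h ℕ./ d) / 1
  D = + 1 / d
  F = + (n ℕ./ d) / 1
  frac-/ : frac (+ n / d) ≡ X * D - F
  frac-/ = cong₂ _-_ (/-as-* (+ n) e) (cong (_/ 1) (floor-/ n d))
  cancel : ∀ X H Q M F → X * H * (M * Q) - M * (X * (Q * H) - F) ≡ M * F
  cancel = solve 5 (λ X H Q M F → X :* H :* (M :* Q) :- M :* (X :* (Q :* H) :- F) := M :* F) refl

fracSum : ℕ → ℕ → ℚ
fracSum n h = sumℚ (map (λ e → (μ (suc e) / 1) * frac (+ n / suc e)) (filter (λ e → suc e ∣? h) (upTo h)))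

coprimeCount-ℚ : ∀ n h → coprimeCount n (suc h) / 1 ≡ + n / 1 * (+ φ (suc h) / suc h) - fracSum n (suc h)
coprimeCount-ℚ n h = begin
  coprimeCount n H / 1
    ≡⟨ cong (_/ 1) (coprimeCount-divisors n H) ⟩
  sumℤ (map (λ e → μ (suc e) ℤ.* + (n ℕ./ suc e)) predDivisors) / 1
    ≡⟨ /1-sumℚ _ predDivisors ⟨
  sumℚ (map (λ e → (μ (suc e) ℤ.* + (n ℕ./ suc e)) / 1) predDivisors)
    ≡⟨ cong sumℚ (List.map-cong-local (All.map (λ {e} → divisor-term n h (suc e)) (all-filter (λ e → suc e ∣? H) (upTo H)))) ⟩
  sumℚ (map (λ e → X * I * φ-summand e - frac-summand e) predDivisors)
    ≡⟨ sumℚ-affine (X * I) φ-summand frac-summand predDivisors ⟩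
  X * I * sumℚ (map φ-summand predDivisors) - fracSum n H
    ≡⟨ cong (λ s → X * I * s - fracSum n H) (trans (/1-sumℚ _ predDivisors) (cong (_/ 1) (sym φ-divisors))) ⟩
  X * I * (+ φ H / 1) - fracSum n H
    ≡⟨ cong (_- fracSum n H) (trans (ℚ.*-assoc X I _) (cong (X *_) (ℚ.*-comm I _))) ⟩
  X * (+ φ H / 1 * I) - fracSum n H
    ≡⟨ cong (λ s → X * s - fracSum n H) (/-as-* (+ φ H) h) ⟨
  X * (+ φ H / H) - fracSum n H
    ∎
  where
  open ≡-Reasoning
  H = suc h
  X = + n / 1
  I = + 1 / H
  predDivisors = filter (λ e → suc e ∣? H) (upTo H)
  φ-summand frac-summand : ℕ → ℚ
  φ-summand e = (μ (suc e) ℤ.* + (H ℕ./ suc e)) / 1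
  frac-summand e = (μ (suc e) / 1) * frac (+ n / suc e)
  φ-divisors : + φ H ≡ sumℤ (map (λ e → μ (suc e) ℤ.* + (H ℕ./ suc e)) predDivisors)
  φ-divisors = trans (+φ≡coprimeCount H) (coprimeCount-divisors H H)

∑coprimeCount-ℚ : ∀ m n →
  (∑[ k < m ] coprimeCount n (suc k)) / 1
    ≡ + n / 1 * sumℚ (map (λ k → + φ (suc k) / suc k) (upTo m)) - sumℚ (map (λ k → fracSum n (suc k)) (upTo m))
∑coprimeCount-ℚ m n = begin
  (∑[ k < m ] coprimeCount n (suc k)) / 1                ≡⟨ cong (_/ 1) (sumℤ-upTo _ m) ⟨
  sumℤ (map (λ k → coprimeCount n (suc k)) (upTo m)) / 1 ≡⟨ /1-sumℚ _ (upTo m) ⟨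
  sumℚ (map (λ k → coprimeCount n (suc k) / 1) (upTo m)) ≡⟨ cong sumℚ (List.map-cong (coprimeCount-ℚ n) (upTo m)) ⟩
  sumℚ (map (λ k → + n / 1 * (+ φ (suc k) / suc k) - fracSum n (suc k)) (upTo m))
    ≡⟨ sumℚ-affine (+ n / 1) (λ k → + φ (suc k) / suc k) (λ k → fracSum n (suc k)) (upTo m) ⟩
  + n / 1 * sumℚ (map (λ k → + φ (suc k) / suc k) (upTo m)) - sumℚ (map (λ k → fracSum n (suc k)) (upTo m)) ∎
  where open ≡-Reasoning

corollary4 : (m n : ℕ) → 0 < m → m < n →
    (+ sum (map (λ k → 𝒩 n (suc k)) (upTo m))) / 1
      ≡ 1ℚ + ((+ n) / 1) * sumℚ (map (λ k → (+ φ (suc k)) / suc k) (upTo m))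
          - (+ Φ m) / 1
          - sumℚ (map (λ k → sumℚ (map (λ e → (μ (suc e) / 1) * frac ((+ n) / suc e))
                                        (filter (λ e → suc e ∣? suc k) (upTo (suc k)))))
                      (upTo m))
corollary4 m n 0<m m<n = begin
  count / 1                                 ≡⟨ add-and-subtract (count / 1) Φℚ ⟩
  count / 1 + Φℚ - Φℚ                       ≡⟨ cong (_- Φℚ) (/1-+ count (+ Φ m)) ⟨
  (count ℤ.+ + Φ m) / 1 - Φℚ                ≡⟨ cong (λ c → c / 1 - Φℚ) (∑𝒩+Φ m n 0<m m<n) ⟩
  (∑C ℤ.+ 1ℤ) / 1 - Φℚ                      ≡⟨ cong (_- Φℚ) (/1-+ ∑C 1ℤ) ⟩
  ∑C / 1 + 1ℚ - Φℚ                          ≡⟨ cong (λ c → c + 1ℚ - Φℚ) (∑coprimeCount-ℚ m n) ⟩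
  X * Sφ - Sfrac + 1ℚ - Φℚ                  ≡⟨ rearrange X Sφ Sfrac Φℚ ⟩
  1ℚ + X * Sφ - Φℚ - Sfrac                  ∎
  where
  open ≡-Reasoning
  open +-*-Solver
  count = + sum (map (λ k → 𝒩 n (suc k)) (upTo m))
  ∑C = ∑[ k < m ] coprimeCount n (suc k)
  X = + n / 1
  Φℚ = + Φ m / 1
  Sφ = sumℚ (map (λ k → + φ (suc k) / suc k) (upTo m))
  Sfrac = sumℚ (map (λ k → fracSum n (suc k)) (upTo m))
  add-and-subtract : ∀ a b → a ≡ a + b - b
  add-and-subtract = solve 2 (λ a b → a := a :+ b :- b) refl
  rearrange : ∀ x s t p → x * s - t + 1ℚ - p ≡ 1ℚ + x * s - p - t
  rearrange = solve 4 (λ x s t p → x :* s :- t :+ con 1ℚ :- p := con 1ℚ :+ x :* s :- p :- t) refl
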